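{- Let $C,\ell,s$ be integers with $\ell>C$ and $s\ge2$, and let $S\subseteq[C]$ be nonempty with $|S|<s$. Let $x,y\in\{0,1\}^k$. If $\mathscr{D}_{s,\ell}(x)=\mathscr{D}_{s,\ell}(y)$, then the multisets $\{x|_S,x'|_S\}$ and $\{y|_S,y'|_S\}$ are equal (both understood to be empty if $S\not\subseteq[k]$).
   Context: A binary string $x\in\{0,1\}^k$ is a function $x:[k]\to\{0,1\}$; its reversal is $x'(i)=x(k-i+1)$. For finite nonempty $S\subset\mathbb{Z}$ with elements $S_1<\dots<S_{|S|}$ and $S\subseteq[k]$, $x|_S$ is the string $i\mapsto x(S_i)$ of length $|S|$ (undefined if $S\not\subseteq[k]$). The $S$-deck $D_S(x)$ is the multiset of strings $g$ of length $|S|$ in which $g$ has multiplicity $\sum_{i\in\mathbb{Z}}\big(I(i+S\subseteq[k],\ x|_{i+S}=g)+I(i+S\subseteq[k],\ x'|_{i+S}=g)\big)$. The width is $\Delta(S)=\max S-\min S+1$. $\mathscr{D}_{s,\ell}(x)$ is the map sending each finite nonempty $S\subset\mathbb{Z}$ with $\Delta(S)\le\ell$ and $|S|\le s$ to $D_S(x)$. -}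

module Defs where

open import Data.Bool using (Bool; true; false)
import Data.Bool.Properties as BoolP
open import Data.Nat as ℕ using (ℕ; zero; suc)
open import Data.Nat.Properties using () renaming (_<?_ to _<ℕ?_)
open import Data.Integer using (ℤ; +_; -[1+_]; _+_; _-_; _<_; _≤_)
open import Data.Fin using (Fin; fromℕ<)
open import Data.Vec using (Vec; lookup; reverse)
open import Data.List using (List; []; _∷_; map; upTo)
open import Data.Nat.ListAction using (sum)
import Data.List.Properties as ListP
open import Data.List.Relation.Unary.Linked using (Linked)
open import Data.List.Relation.Unary.All using (All)
open import Data.Maybe using (Maybe; just; nothing)
import Data.Maybe.Properties as MaybeP
open import Data.Product using (_×_)
open import Relation.Binary.PropositionalEquality using (_≡_; _≢_)
open import Relation.Nullary using (does; yes; no)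

-- A binary string of length k, positions 1..k (position j is index j-1).
BinStr : ℕ → Set
BinStr k = Vec Bool k

rev : ∀ {k} → BinStr k → BinStr k
rev = reverse

-- A finite nonempty set S ⊂ ℤ, represented by its elements listed
-- in strictly increasing order S₁ < … < S_|S|.
IsFinSet : List ℤ → Set
IsFinSet S = (S ≢ []) × Linked _<_ S

card : List ℤ → ℕ
card = Data.List.length

lastOr : ℤ → List ℤ → ℤ
lastOr a []       = a
lastOr a (b ∷ bs) = lastOr b bs

-- width Δ(S) = max S - min S + 1  (for a sorted nonempty list)
width : List ℤ → ℤ
width []       = + 0
width (a ∷ as) = lastOr a as - a + + 1

SubsetRange : ℕ → List ℤ → Set
SubsetRange C S = All (λ j → (+ 1 ≤ j) × (j ≤ + C)) S

pos : (k : ℕ) → ℤ → Maybe (Fin k)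
pos k (+ zero)  = nothing
pos k (+ suc n) with n <ℕ? k
... | yes p = just (fromℕ< p)
... | no _  = nothing
pos k -[1+ n ]  = nothing

restrict : ∀ {k} → BinStr k → List ℤ → Maybe (List Bool)
restrict x []      = just []
restrict {k} x (j ∷ S) with pos k j | restrict x S
... | just p  | just r = just (lookup x p ∷ r)
... | _       | _      = nothing

shift : ℤ → List ℤ → List ℤ
shift i = map (λ j → i + j)

ind : ∀ {k} → BinStr k → List ℤ → List Bool → ℕ
ind x T g with MaybeP.≡-dec (ListP.≡-dec BoolP._≟_) (restrict x T) (just g)
... | yes _ = 1
... | no _  = 0

-- Multiplicity of g in the S-deck D_S(x):
--   Σ_{i ∈ ℤ} I(i+S ⊆ [k], x|_{i+S} = g) + I(i+S ⊆ [k], x'|_{i+S} = g).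
-- For nonempty S with minimum a, only shifts i with 1 ≤ i + a ≤ k can
-- contribute, i.e. i = (j+1) - a for j = 0,…,k-1; the sum is over these.
deckMult : ∀ {k} → BinStr k → List ℤ → List Bool → ℕ
deckMult x []      g = 0
deckMult {k} x (a ∷ S) g =
  sum (map (λ j → let T = shift (+ suc j - a) (a ∷ S)
                  in ind x T g ℕ.+ ind (rev x) T g) (upTo k))

SameDeck : ∀ {k} → List ℤ → BinStr k → BinStr k → Set
SameDeck S x y = ∀ g → deckMult x S g ≡ deckMult y S g

SameDecks : ∀ {k} → ℕ → ℕ → BinStr k → BinStr k → Set
SameDecks s ℓ x y =
  ∀ (S : List ℤ) → IsFinSet S → width S ≤ + ℓ → card S ℕ.≤ s → SameDeck S x y

-- multiset {x|_S, x'|_S} (entries omitted when S ⊄ [k]): multiplicity of g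
pairMult : ∀ {k} → BinStr k → List ℤ → List Bool → ℕ
pairMult x S g = ind x S g ℕ.+ ind (rev x) S g

SamePair : ∀ {k} → List ℤ → BinStr k → BinStr k → Set
SamePair S x y = ∀ g → pairMult x S g ≡ pairMult y S g

{-# OPTIONS --safe #-}
-- Let H(i) count g among x|_{i+S} and x'|_{i+S}; the claim is that H(0) agrees for
-- x and y. Adjoining a position c to the left of S and summing the ({c} ∪ S)-deck over
-- the bit at c gives Σ H(i) over the shifts with i + c ∈ [k]. For c = 0 and c = 1
-- these sets have width ≤ C + 1 ≤ ℓ and size ≤ |S| + 1 ≤ s, so Σ_{i=1}^{k} H(i) and
-- Σ_{i=0}^{k-1} H(i) agree for x and y. As min S ≥ 1 the window k + S leaves [k],
-- so H(k) = 0 and H(0) is the difference of these two sums.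
module Submission where

open import Defs
open import Data.Nat using (ℕ; _<_; _≤_)
open import Data.List using (List)
open import Data.Integer using (ℤ)

open import Data.Bool using (Bool; true; false; if_then_else_)
import Data.Bool.Properties as Bool
open import Data.Empty using (⊥-elim)
open import Data.Fin using (Fin; fromℕ<)
open import Data.Integer as ℤ using (+_; +≤+; +<+)
import Data.Integer.Properties as ℤ
open import Data.List using ([]; _∷_; map; upTo; applyUpTo; _++_; [_])
import Data.List.Properties as List
open import Data.List.Relation.Unary.All as All using ([]; _∷_)
open import Data.List.Relation.Unary.All.Properties using (all-upTo)
open import Data.List.Relation.Unary.Linked using (Linked; _∷_)
open import Data.Maybe using (Maybe; just; nothing)
import Data.Maybe as Maybe
import Data.Maybe.Properties as Maybe
open import Data.Nat using (suc; _+_; s≤s; z≤n)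
open import Data.Nat.ListAction using (sum)
open import Data.Nat.ListAction.Properties using (sum-++)
open import Data.Nat.Properties as ℕ
  using (+-identityʳ; +-cancelʳ-≡; <⇒≤; <⇒≱; m<m+n; _<?_)
open import Algebra.Properties.CommutativeSemigroup ℕ.+-commutativeSemigroup using (interchange)
open import Data.Product using (∃; _,_)
open import Data.Vec using (lookup)
open import Function using (_∘_)
open import Relation.Binary.PropositionalEquality using (_≡_; refl; sym; trans; cong; cong₂; module ≡-Reasoning)
open import Relation.Nullary using (does; yes; no)

open ≡-Reasoning

sum-map-+ : ∀ {A : Set} (f h : A → ℕ) xs →
  sum (map (λ a → f a + h a) xs) ≡ sum (map f xs) + sum (map h xs)
sum-map-+ f h []       = refl
sum-map-+ f h (a ∷ xs) = begin
  (f a + h a) + sum (map (λ a → f a + h a) xs)  ≡⟨ cong (_+_ (f a + h a)) (sum-map-+ f h xs) ⟩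
  (f a + h a) + (sum (map f xs) + sum (map h xs)) ≡⟨ interchange (f a) (h a) _ _ ⟩
  (f a + sum (map f xs)) + (h a + sum (map h xs)) ∎

sum-upTo-telescope : ∀ (f : ℕ → ℕ) n →
  f 0 + sum (map (f ∘ suc) (upTo n)) ≡ sum (map f (upTo n)) + f n
sum-upTo-telescope f n = begin
  f 0 + sum (map (f ∘ suc) (upTo n))   ≡⟨ cong (λ l → f 0 + sum l) upTo-suc ⟩
  sum (map f (upTo (suc n)))           ≡⟨ cong (sum ∘ map f) (List.upTo-∷ʳ n) ⟨
  sum (map f (upTo n ++ [ n ]))        ≡⟨ cong sum (List.map-++ f (upTo n) [ n ]) ⟩
  sum (map f (upTo n) ++ [ f n ])      ≡⟨ sum-++ (map f (upTo n)) [ f n ] ⟩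
  sum (map f (upTo n)) + (f n + 0)     ≡⟨ cong (_+_ (sum (map f (upTo n)))) (+-identityʳ (f n)) ⟩
  sum (map f (upTo n)) + f n           ∎
  where
  upTo-suc : map (f ∘ suc) (upTo n) ≡ map f (applyUpTo suc n)
  upTo-suc = trans (List.map-upTo (f ∘ suc) n) (sym (List.map-applyUpTo suc f n))

minus-plus : ∀ i j → i ℤ.- j ℤ.+ j ≡ i
minus-plus i j = begin
  i ℤ.- j ℤ.+ j       ≡⟨ ℤ.+-assoc i (ℤ.- j) j ⟩
  i ℤ.+ (ℤ.- j ℤ.+ j) ≡⟨ cong (ℤ._+_ i) (ℤ.+-inverseˡ j) ⟩
  i ℤ.+ + 0           ≡⟨ ℤ.+-identityʳ i ⟩
  i                   ∎

pos-in-range : ∀ {k j} → j < k → ∃ λ (q : Fin k) → pos k (+ suc j) ≡ just q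
pos-in-range {k} {j} j<k with j <? k
... | yes j<k′ = fromℕ< j<k′ , refl
... | no  j≮k  = ⊥-elim (j≮k j<k)

pos-beyond : ∀ {k n} → k < n → pos k (+ n) ≡ nothing
pos-beyond {k} {suc n} (s≤s k≤n) with n <? k
... | yes n<k = ⊥-elim (<⇒≱ n<k k≤n)
... | no  _   = refl

restrict-∷ : ∀ {k} (x : BinStr k) p {q} T → pos k p ≡ just q →
  restrict x (p ∷ T) ≡ Maybe.map (lookup x q ∷_) (restrict x T)
restrict-∷ x p T p↦q rewrite p↦q with restrict x T
... | just _  = refl
... | nothing = refl

restrict-∷-outside : ∀ {k} (x : BinStr k) p T → pos k p ≡ nothing → restrict x (p ∷ T) ≡ nothing
restrict-∷-outside x p T p↦∅ rewrite p↦∅ = refl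

hits : Maybe (List Bool) → List Bool → ℕ
hits m g = if does (Maybe.≡-dec (List.≡-dec Bool._≟_) m (just g)) then 1 else 0

ind≡hits : ∀ {k} (x : BinStr k) T g → ind x T g ≡ hits (restrict x T) g
ind≡hits x T g with Maybe.≡-dec (List.≡-dec Bool._≟_) (restrict x T) (just g)
... | yes _ = refl
... | no  _ = refl

hits-marginal : ∀ b m g →
  hits (Maybe.map (b ∷_) m) (true ∷ g) + hits (Maybe.map (b ∷_) m) (false ∷ g) ≡ hits m g
hits-marginal b     nothing  g = refl
hits-marginal true  (just r) g = +-identityʳ (hits (just r) g)
hits-marginal false (just r) g = refl

ind-marginal : ∀ {k} (x : BinStr k) p {q} T g → pos k p ≡ just q →
  ind x (p ∷ T) (true ∷ g) + ind x (p ∷ T) (false ∷ g) ≡ ind x T g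
ind-marginal x p {q} T g p↦q = begin
  ind x (p ∷ T) (true ∷ g) + ind x (p ∷ T) (false ∷ g)
    ≡⟨ cong₂ _+_ (ind≡hits x (p ∷ T) (true ∷ g)) (ind≡hits x (p ∷ T) (false ∷ g)) ⟩
  hits (restrict x (p ∷ T)) (true ∷ g) + hits (restrict x (p ∷ T)) (false ∷ g)
    ≡⟨ cong (λ m → hits m (true ∷ g) + hits m (false ∷ g)) (restrict-∷ x p T p↦q) ⟩
  hits (Maybe.map (lookup x q ∷_) (restrict x T)) (true ∷ g)
    + hits (Maybe.map (lookup x q ∷_) (restrict x T)) (false ∷ g)
    ≡⟨ hits-marginal (lookup x q) (restrict x T) g ⟩
  hits (restrict x T) g
    ≡⟨ ind≡hits x T g ⟨
  ind x T g ∎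

ind-outside : ∀ {k} (x : BinStr k) p T g → pos k p ≡ nothing → ind x (p ∷ T) g ≡ 0
ind-outside x p T g p↦∅ = trans (ind≡hits x (p ∷ T) g) (cong (λ m → hits m g) (restrict-∷-outside x p T p↦∅))

pairMult-marginal : ∀ {k} (x : BinStr k) p {q} T g → pos k p ≡ just q →
  pairMult x (p ∷ T) (true ∷ g) + pairMult x (p ∷ T) (false ∷ g) ≡ pairMult x T g
pairMult-marginal x p T g p↦q =
  trans (interchange (ind x (p ∷ T) (true ∷ g)) (ind (rev x) (p ∷ T) (true ∷ g))
                     (ind x (p ∷ T) (false ∷ g)) (ind (rev x) (p ∷ T) (false ∷ g)))
        (cong₂ _+_ (ind-marginal x p T g p↦q) (ind-marginal (rev x) p T g p↦q))

pairMult-outside : ∀ {k} (x : BinStr k) p T g → pos k p ≡ nothing → pairMult x (p ∷ T) g ≡ 0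
pairMult-outside x p T g p↦∅ = cong₂ _+_ (ind-outside x p T g p↦∅) (ind-outside (rev x) p T g p↦∅)

-- Σ H(i) over the shifts i with i + c ∈ [k], where H(i) = pairMult x (i + S) g.
windowCount : ∀ {k} → BinStr k → List ℤ → List Bool → ℤ → ℕ
windowCount {k} x S g c = sum (map (λ j → pairMult x (shift (+ suc j ℤ.- c) S) g) (upTo k))

deckMult-marginal : ∀ {k} (x : BinStr k) c S g →
  deckMult x (c ∷ S) (true ∷ g) + deckMult x (c ∷ S) (false ∷ g) ≡ windowCount x S g c
deckMult-marginal {k} x c S g = begin
  deckMult x (c ∷ S) (true ∷ g) + deckMult x (c ∷ S) (false ∷ g)
    ≡⟨ sum-map-+ (λ j → pairMult x (shift (i j) (c ∷ S)) (true ∷ g))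
                 (λ j → pairMult x (shift (i j) (c ∷ S)) (false ∷ g)) (upTo k) ⟨
  sum (map (λ j → pairMult x (shift (i j) (c ∷ S)) (true ∷ g)
                + pairMult x (shift (i j) (c ∷ S)) (false ∷ g)) (upTo k))
    ≡⟨ cong sum (List.map-cong-local (All.map marginal (all-upTo k))) ⟩
  windowCount x S g c ∎
  where
  i : ℕ → ℤ
  i j = + suc j ℤ.- c
  marginal : ∀ {j} → j < k →
    pairMult x (shift (i j) (c ∷ S)) (true ∷ g) + pairMult x (shift (i j) (c ∷ S)) (false ∷ g)
      ≡ pairMult x (shift (i j) S) g
  marginal {j} j<k with q , j↦q ← pos-in-range j<k =
    pairMult-marginal x (i j ℤ.+ c) (shift (i j) S) g (trans (cong (pos k) (minus-plus (+ suc j) c)) j↦q)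

shift-zero : ∀ T → shift (+ 0) T ≡ T
shift-zero T = trans (List.map-cong ℤ.+-identityˡ T) (List.map-id T)

windowCount-telescope : ∀ {k} (x : BinStr k) {a} S g → + 1 ℤ.≤ a →
  pairMult x (a ∷ S) g + windowCount x (a ∷ S) g (+ 0) ≡ windowCount x (a ∷ S) g (+ 1)
windowCount-telescope {k} x {+ suc n} S g (+≤+ (s≤s z≤n)) = begin
  pairMult x T g + windowCount x T g (+ 0)
    ≡⟨ cong₂ _+_ (cong (λ T′ → pairMult x T′ g) (sym (shift-zero T)))
                 (cong sum (List.map-cong (λ j → cong H′ (ℤ.+-identityʳ (+ suc j))) (upTo k))) ⟩
  H 0 + sum (map (H ∘ suc) (upTo k))
    ≡⟨ sum-upTo-telescope H k ⟩
  sum (map H (upTo k)) + H k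
    ≡⟨ cong (_+_ (sum (map H (upTo k)))) (pairMult-outside x (+ (k + suc n)) (shift (+ k) S) g k+a↦∅) ⟩
  sum (map H (upTo k)) + 0
    ≡⟨ +-identityʳ _ ⟩
  windowCount x T g (+ 1) ∎
  where
  T : List ℤ
  T = + suc n ∷ S
  H′ : ℤ → ℕ
  H′ i = pairMult x (shift i T) g
  H : ℕ → ℕ
  H j = H′ (+ j)
  k+a↦∅ : pos k (+ (k + suc n)) ≡ nothing
  k+a↦∅ = pos-beyond (m<m+n k (s≤s z≤n))

windowCount-cong : ∀ {k} (x y : BinStr k) c S g → SameDeck (c ∷ S) x y →
  windowCount x S g c ≡ windowCount y S g c
windowCount-cong x y c S g same = begin
  windowCount x S g c                                             ≡⟨ deckMult-marginal x c S g ⟨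
  deckMult x (c ∷ S) (true ∷ g) + deckMult x (c ∷ S) (false ∷ g) ≡⟨ cong₂ _+_ (same (true ∷ g)) (same (false ∷ g)) ⟩
  deckMult y (c ∷ S) (true ∷ g) + deckMult y (c ∷ S) (false ∷ g) ≡⟨ deckMult-marginal y c S g ⟩
  windowCount y S g c                                             ∎

lastOr-≤ : ∀ {C} a S → SubsetRange C (a ∷ S) → lastOr a S ℤ.≤ + C
lastOr-≤ a []      ((_ , a≤C) ∷ []) = a≤C
lastOr-≤ a (b ∷ S) (_ ∷ inRange)    = lastOr-≤ b S inRange

width-≤ : ∀ {ℓ} n T → lastOr (+ n) T ℤ.< + ℓ → width (+ n ∷ T) ℤ.≤ + ℓ
width-≤ n T last<ℓ =
  ℤ.≤-trans (ℤ.+-monoˡ-≤ (+ 1) (ℤ.i-j≤i (lastOr (+ n) T) (+ n)))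
            (ℤ.≤-trans (ℤ.≤-reflexive (ℤ.+-comm (lastOr (+ n) T) (+ 1))) (ℤ.i<j⇒suc[i]≤j last<ℓ))

windowCount₀-cong : ∀ {s ℓ k} {x y : BinStr k} a S g → + 1 ℤ.≤ a → Linked ℤ._<_ (a ∷ S) →
  lastOr a S ℤ.< + ℓ → card (a ∷ S) < s → SameDecks s ℓ x y →
  windowCount x (a ∷ S) g (+ 0) ≡ windowCount y (a ∷ S) g (+ 0)
windowCount₀-cong {x = x} {y} a S g 1≤a sorted last<ℓ |S|<s same =
  windowCount-cong x y (+ 0) (a ∷ S) g
    (same (+ 0 ∷ a ∷ S) ((λ ()) , ℤ.suc[i]≤j⇒i<j 1≤a ∷ sorted) (width-≤ 0 (a ∷ S) last<ℓ) |S|<s)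

-- If min S = 1 these window counts form the S-deck itself; otherwise 1 can be adjoined to S.
windowCount₁-cong : ∀ {s ℓ k} {x y : BinStr k} a S g → + 1 ℤ.≤ a → Linked ℤ._<_ (a ∷ S) →
  lastOr a S ℤ.< + ℓ → card (a ∷ S) < s → SameDecks s ℓ x y →
  windowCount x (a ∷ S) g (+ 1) ≡ windowCount y (a ∷ S) g (+ 1)
windowCount₁-cong (+ 0) S g (+≤+ ()) _ _ _ _
windowCount₁-cong (+ 1) S g _ sorted last<ℓ |S|<s same =
  same (+ 1 ∷ S) ((λ ()) , sorted) (width-≤ 1 S last<ℓ) (<⇒≤ |S|<s) g
windowCount₁-cong {x = x} {y} a@(+ suc (suc _)) S g _ sorted last<ℓ |S|<s same =
  windowCount-cong x y (+ 1) (a ∷ S) g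
    (same (+ 1 ∷ a ∷ S) ((λ ()) , +<+ (s≤s (s≤s z≤n)) ∷ sorted) (width-≤ 1 (a ∷ S) last<ℓ) |S|<s)

lemma5p2 : (C ℓ s k : ℕ) → C < ℓ → 2 ≤ s →
    (S : List ℤ) → IsFinSet S → SubsetRange C S → card S < s →
    (x y : BinStr k) → SameDecks s ℓ x y → SamePair S x y
lemma5p2 C ℓ s k C<ℓ _ [] (S≢[] , _) _ _ x y _ g = ⊥-elim (S≢[] refl)
lemma5p2 C ℓ s k C<ℓ _ S@(a ∷ S′) (_ , sorted) inRange@((1≤a , _) ∷ _) |S|<s x y same g =
  +-cancelʳ-≡ (windowCount y S g (+ 0)) (pairMult x S g) (pairMult y S g) (begin
    pairMult x S g + windowCount y S g (+ 0) ≡⟨ cong (_+_ (pairMult x S g)) windows₀ ⟨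
    pairMult x S g + windowCount x S g (+ 0) ≡⟨ windowCount-telescope x S′ g 1≤a ⟩
    windowCount x S g (+ 1)                  ≡⟨ windowCount₁-cong a S′ g 1≤a sorted last<ℓ |S|<s same ⟩
    windowCount y S g (+ 1)                  ≡⟨ windowCount-telescope y S′ g 1≤a ⟨
    pairMult y S g + windowCount y S g (+ 0) ∎)
  where
  last<ℓ : lastOr a S′ ℤ.< + ℓ
  last<ℓ = ℤ.≤-<-trans (lastOr-≤ a S′ inRange) (+<+ C<ℓ)
  windows₀ : windowCount x S g (+ 0) ≡ windowCount y S g (+ 0)
  windows₀ = windowCount₀-cong a S′ g 1≤a sorted last<ℓ |S|<s same
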